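{- Let $M$ be a poset, let $D$ be a distributive lattice, let $d\colon M\times M\to D$, let $f\colon M\to D$ be an isotone map, let $\sqsubseteq$ be a finitely shadowing well-ordering of $M$, and let $d'$ be the monotone adjustment of $d$ with respect to $\sqsubseteq$. If $f(x)\leq f(y)\vee d(x,y)$ for all $x,y\in M$, then $f(a)\leq f(b)\vee d'(a,b)$ for all $a,b\in M$.
   Context: For $A\subseteq M$ and $x\in M$, $U\subseteq A$ is a lower shadow of $x$ on $A$ if $A\cap\{y:y\leq x\}=A\cap\{y:y\leq u\text{ for some }u\in U\}$, upper shadows dually; $A$ is finitely shadowing in $M$ if every element has a finite lower and a finite upper shadow on $A$. A well-ordering $\sqsubseteq$ on the set $M$ is finitely shadowing if $\{y:y\sqsubseteq x\}$ is finitely shadowing in $(M,\leq)$ for all $x$. For $x,y,x',y'\in M$ put $\{x,y\}\unlhd\{x',y'\}$ if $\max_\sqsubseteq\{x,y\}\sqsubset\max_\sqsubseteq\{x',y'\}$, or the maxima are equal and $\min_\sqsubseteq\{x,y\}\sqsubseteq\min_\sqsubseteq\{x',y'\}$; $\lhd$ is the strict part. The monotone adjustment of $d$ is the unique map $d'\colon M\times M\to D$ such that for all $a,b$: the set $S_\wedge(a,b)=\{d(a,b)\}\cup\{d'(x,y):\{x,y\}\lhd\{a,b\},a\leq x,y\leq b\}$ has a finitary meet $d'_\wedge(a,b)$ (i.e., it has a finite coinitial subset whose meet is $d'_\wedge(a,b)$), the set $S_\vee(a,b)=\{d'(x,y):\{x,y\}\lhd\{a,b\},x\leq a,b\leq y\}$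 is empty or has a finitary join $d'_\vee(a,b)$ (a finite cofinal subset with that join), and $d'(a,b)=d'_\wedge(a,b)\vee d'_\vee(a,b)$ (with $d'(a,b)=d'_\wedge(a,b)$ if $S_\vee(a,b)=\varnothing$); such a map exists and is monotone. -}

module Defs where

open import Level using (0ℓ)
open import Data.Product using (Σ; Σ-syntax; _×_; ∃; ∃-syntax)
open import Data.Sum using (_⊎_)
open import Data.List using (List)
open import Data.List.NonEmpty using (List⁺; foldr₁)
open import Data.List.Membership.Propositional using (_∈_)
open import Data.List.Relation.Unary.All using (All)
open import Relation.Binary.PropositionalEquality using (_≡_)
open import Relation.Nullary using (¬_)
open import Relation.Binary.Definitions using (Transitive; Antisymmetric; Total)
open import Induction.WellFounded using (WellFounded)
open import Function.Bundles using (_⇔_)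
open import Algebra.Lattice.Bundles using (DistributiveLattice)

record IsPosetOn (M : Set) (_≤_ : M → M → Set) : Set where
  field
    refl′  : ∀ x → x ≤ x
    trans′ : Transitive _≤_
    antisym′ : Antisymmetric _≡_ _≤_

Strict : {M : Set} → (M → M → Set) → M → M → Set
Strict _⊑_ x y = x ⊑ y × ¬ (x ≡ y)

record IsWellOrdering (M : Set) (_⊑_ : M → M → Set) : Set where
  field
    isPoset : IsPosetOn M _⊑_
    total   : Total _⊑_
    wf      : WellFounded (Strict _⊑_)

-- Shadows (subsets of M are predicates; finite subsets are lists)

module _ {M : Set} (_≤_ : M → M → Set) where

  IsLowerShadow : (A : M → Set) → M → List M → Set
  IsLowerShadow A x U =
    All A U × (∀ y → (A y × y ≤ x) ⇔ (A y × Σ[ u ∈ M ] (u ∈ U × y ≤ u)))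

  IsUpperShadow : (A : M → Set) → M → List M → Set
  IsUpperShadow A x U =
    All A U × (∀ y → (A y × x ≤ y) ⇔ (A y × Σ[ u ∈ M ] (u ∈ U × u ≤ y)))

  IsFinitelyShadowing : (A : M → Set) → Set
  IsFinitelyShadowing A =
    ∀ x → (Σ[ U ∈ List M ] IsLowerShadow A x U) × (Σ[ U ∈ List M ] IsUpperShadow A x U)

  IsFinitelyShadowingOrder : (M → M → Set) → Set
  IsFinitelyShadowingOrder _⊑_ = ∀ x → IsFinitelyShadowing (λ y → y ⊑ x)

module _ {M : Set} (_⊑_ : M → M → Set) where

  IsMaxOf : M → M → M → Set
  IsMaxOf m x y = (m ≡ x ⊎ m ≡ y) × x ⊑ m × y ⊑ m

  IsMinOf : M → M → M → Set
  IsMinOf m x y = (m ≡ x ⊎ m ≡ y) × m ⊑ x × m ⊑ y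

  PairLe : M → M → M → M → Set
  PairLe x y x' y' = ∀ m n m' n' → IsMaxOf m x y → IsMinOf n x y →
    IsMaxOf m' x' y' → IsMinOf n' x' y' →
    Strict _⊑_ m m' ⊎ (m ≡ m' × n ⊑ n')

  PairLt : M → M → M → M → Set
  PairLt x y x' y' = PairLe x y x' y' × ¬ PairLe x' y' x y

module _ (D : DistributiveLattice 0ℓ 0ℓ) where
  open DistributiveLattice D

  _≤D_ : Carrier → Carrier → Set
  x ≤D y = x ≈ x ∧ y

  ⋀⁺ : List⁺ Carrier → Carrier
  ⋀⁺ = foldr₁ _∧_

  ⋁⁺ : List⁺ Carrier → Carrier
  ⋁⁺ = foldr₁ _∨_

  _∈⁺_ : Carrier → List⁺ Carrier → Set
  u ∈⁺ U = u ∈ Data.List.NonEmpty.toList U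

  IsFinitaryMeet : (Carrier → Set) → Carrier → Set
  IsFinitaryMeet S m = Σ[ U ∈ List⁺ Carrier ]
    (All S (Data.List.NonEmpty.toList U)
     × (∀ s → S s → Σ[ u ∈ Carrier ] (u ∈⁺ U × u ≤D s))
     × m ≈ ⋀⁺ U)

  IsFinitaryJoin : (Carrier → Set) → Carrier → Set
  IsFinitaryJoin S j = Σ[ U ∈ List⁺ Carrier ]
    (All S (Data.List.NonEmpty.toList U)
     × (∀ s → S s → Σ[ u ∈ Carrier ] (u ∈⁺ U × s ≤D u))
     × j ≈ ⋁⁺ U)

  IsEmpty : (Carrier → Set) → Set
  IsEmpty S = ∀ z → ¬ S z

  module _ {M : Set} (_≤_ : M → M → Set) (_⊑_ : M → M → Set)
           (d d' : M → M → Carrier) where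

    S∧ : M → M → Carrier → Set
    S∧ a b z = z ≈ d a b
      ⊎ Σ[ x ∈ M ] Σ[ y ∈ M ] (PairLt _⊑_ x y a b × a ≤ x × y ≤ b × z ≈ d' x y)

    S∨ : M → M → Carrier → Set
    S∨ a b z =
      Σ[ x ∈ M ] Σ[ y ∈ M ] (PairLt _⊑_ x y a b × x ≤ a × b ≤ y × z ≈ d' x y)

    IsMonotoneAdjustment : Set
    IsMonotoneAdjustment = ∀ a b → Σ[ mw ∈ Carrier ]
      (IsFinitaryMeet (S∧ a b) mw
       × ((IsEmpty (S∨ a b) × d' a b ≈ mw)
          ⊎ Σ[ mj ∈ Carrier ] (IsFinitaryJoin (S∨ a b) mj × d' a b ≈ mw ∨ mj)))

-- Induct along ◁, which is well-founded because it is the lexicographic order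
-- on (max, min) of a pair with respect to the well-ordering ⊑.  Every member s
-- of S∧(a, b) satisfies f a ≤ f b ∨ s: for s = d(a, b) by hypothesis, and for
-- s = d'(x, y) with {x, y} ◁ {a, b}, a ≤ x, y ≤ b by the induction hypothesis
-- and isotony of f.  Distributivity of ∨ over ∧ passes this bound to the finite
-- meet d'∧(a, b), and d'∧(a, b) ≤ d'(a, b) by construction.
module Submission where

open import Defs
open import Level using (0ℓ)
open import Algebra.Lattice.Bundles using (DistributiveLattice)
import Algebra.Lattice.Properties.Lattice as LatticeProperties
import Relation.Binary.Lattice as OrderLattice
import Relation.Binary.Lattice.Properties.JoinSemilattice as JoinSemilatticeProperties
import Relation.Binary.Reasoning.PartialOrder as PartialOrderReasoning
open import Data.Product using (Σ-syntax; _×_; _,_)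
open import Data.Sum using (_⊎_; inj₁; inj₂)
open import Data.List using ([]; _∷_)
open import Data.List.NonEmpty using (List⁺; _∷_; toList)
open import Data.List.Relation.Unary.All using (All; []; _∷_)
import Data.List.Relation.Unary.All as All
open import Relation.Binary.PropositionalEquality using (_≡_; refl)
import Relation.Binary.PropositionalEquality as ≡
open import Induction.WellFounded using (WellFounded; WfRec; module Subrelation)
  renaming (module All to WfAll)
import Relation.Binary.Construct.On as On
open import Data.Product.Relation.Binary.Lex.Strict using (×-Lex; ×-wellFounded)

module DistributiveLatticeProperties (D : DistributiveLattice 0ℓ 0ℓ) where
  open DistributiveLattice D
  open OrderLattice.Lattice (LatticeProperties.∨-∧-orderTheoreticLattice lattice)
    using (joinSemilattice; ∧-greatest; x≤x∨y) renaming (refl to ≤-refl)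
  open OrderLattice.Lattice (LatticeProperties.∨-∧-orderTheoreticLattice lattice) public
    using (poset)
  open JoinSemilatticeProperties joinSemilattice using (∨-monotonic)
  open PartialOrderReasoning poset

  ∨-monoʳ-≤ : ∀ z {x y} → _≤D_ D x y → _≤D_ D (z ∨ x) (z ∨ y)
  ∨-monoʳ-≤ z x≤y = ∨-monotonic (≤-refl {z}) x≤y

  ∨-monoˡ-≤ : ∀ z {x y} → _≤D_ D x y → _≤D_ D (x ∨ z) (y ∨ z)
  ∨-monoˡ-≤ z x≤y = ∨-monotonic x≤y (≤-refl {z})

  ∨-⋀⁺-greatest : ∀ {x z} (U : List⁺ Carrier) →
    All (λ u → _≤D_ D x (z ∨ u)) (toList U) → _≤D_ D x (z ∨ ⋀⁺ D U)
  ∨-⋀⁺-greatest (u ∷ []) (x≤z∨u ∷ []) = x≤z∨u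
  ∨-⋀⁺-greatest {x} {z} (u ∷ v ∷ vs) (x≤z∨u ∷ x≤z∨vs) = begin
    x                             ≤⟨ ∧-greatest x≤z∨u (∨-⋀⁺-greatest (v ∷ vs) x≤z∨vs) ⟩
    (z ∨ u) ∧ (z ∨ ⋀⁺ D (v ∷ vs)) ≈⟨ sym (∨-distribˡ-∧ z u (⋀⁺ D (v ∷ vs))) ⟩
    z ∨ ⋀⁺ D (u ∷ v ∷ vs)         ∎

  finitaryMeet-∨-greatest : ∀ {S m x z} → IsFinitaryMeet D S m →
    (∀ s → S s → _≤D_ D x (z ∨ s)) → _≤D_ D x (z ∨ m)
  finitaryMeet-∨-greatest {m = m} {x} {z} (U , U⊆S , _ , m≈⋀U) bound = begin
    x           ≤⟨ ∨-⋀⁺-greatest U (All.map (bound _) U⊆S) ⟩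
    z ∨ ⋀⁺ D U  ≈⟨ ∨-congˡ (sym m≈⋀U) ⟩
    z ∨ m       ∎

  monotoneAdjustment-meetPart≤ : ∀ {M : Set} {_≤_ _⊑_ : M → M → Set} {d d' : M → M → Carrier} →
    IsMonotoneAdjustment D _≤_ _⊑_ d d' →
    ∀ a b → Σ[ m ∈ Carrier ] (IsFinitaryMeet D (S∧ D _≤_ _⊑_ d d' a b) m × _≤D_ D m (d' a b))
  monotoneAdjustment-meetPart≤ {d' = d'} adjustment a b with adjustment a b
  ... | m , m-meet , inj₁ (_ , d'≈m) = m , m-meet , (begin m ≈⟨ sym d'≈m ⟩ d' a b ∎)
  ... | m , m-meet , inj₂ (j , _ , d'≈m∨j) = m , m-meet , (begin
    m      ≤⟨ x≤x∨y m j ⟩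
    m ∨ j  ≈⟨ sym d'≈m∨j ⟩
    d' a b ∎)

module PairOrder {M : Set} {_⊑_ : M → M → Set} (wo : IsWellOrdering M _⊑_) where
  open IsWellOrdering wo
  open IsPosetOn isPoset

  ⊑-reflexive : ∀ {x y} → x ≡ y → x ⊑ y
  ⊑-reflexive refl = refl′ _

  max min : M → M → M
  max x y with total x y
  ... | inj₁ _ = y
  ... | inj₂ _ = x
  min x y with total x y
  ... | inj₁ _ = x
  ... | inj₂ _ = y

  max-isMax : ∀ x y → IsMaxOf _⊑_ (max x y) x y
  max-isMax x y with total x y
  ... | inj₁ x⊑y = inj₂ refl , x⊑y , refl′ y
  ... | inj₂ y⊑x = inj₁ refl , refl′ x , y⊑x

  min-isMin : ∀ x y → IsMinOf _⊑_ (min x y) x y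
  min-isMin x y with total x y
  ... | inj₁ x⊑y = inj₁ refl , refl′ x , x⊑y
  ... | inj₂ y⊑x = inj₂ refl , y⊑x , refl′ y

  one-of-⊑ : ∀ {m x y u} → (m ≡ x ⊎ m ≡ y) → x ⊑ u → y ⊑ u → m ⊑ u
  one-of-⊑ (inj₁ refl) x⊑u _ = x⊑u
  one-of-⊑ (inj₂ refl) _ y⊑u = y⊑u

  ⊑-one-of : ∀ {m x y l} → (m ≡ x ⊎ m ≡ y) → l ⊑ x → l ⊑ y → l ⊑ m
  ⊑-one-of (inj₁ refl) l⊑x _ = l⊑x
  ⊑-one-of (inj₂ refl) _ l⊑y = l⊑y

  isMax-unique : ∀ {m m' x y} → IsMaxOf _⊑_ m x y → IsMaxOf _⊑_ m' x y → m ≡ m'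
  isMax-unique (m∈ , x⊑m , y⊑m) (m'∈ , x⊑m' , y⊑m') =
    antisym′ (one-of-⊑ m∈ x⊑m' y⊑m') (one-of-⊑ m'∈ x⊑m y⊑m)

  isMin-unique : ∀ {n n' x y} → IsMinOf _⊑_ n x y → IsMinOf _⊑_ n' x y → n ≡ n'
  isMin-unique (n∈ , n⊑x , n⊑y) (n'∈ , n'⊑x , n'⊑y) =
    antisym′ (⊑-one-of n'∈ n⊑x n⊑y) (⊑-one-of n∈ n'⊑x n'⊑y)

  PairLe-intro : ∀ {x y a b} → max x y ≡ max a b → min x y ⊑ min a b → PairLe _⊑_ x y a b
  PairLe-intro {x} {y} {a} {b} max≡ min⊑ m n m' n' m-max n-min m'-max n'-min =
    inj₂ ( ≡.trans (isMax-unique m-max (max-isMax x y)) (≡.trans max≡ (isMax-unique (max-isMax a b) m'-max))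
         , trans′ (⊑-reflexive (isMin-unique n-min (min-isMin x y)))
                  (trans′ min⊑ (⊑-reflexive (isMin-unique (min-isMin a b) n'-min))) )

  _◁_ : M × M → M × M → Set
  (x , y) ◁ (a , b) = PairLt _⊑_ x y a b

  maxMin : M × M → M × M
  maxMin (x , y) = max x y , min x y

  ◁⇒lex : ∀ {p q} → p ◁ q → ×-Lex _≡_ (Strict _⊑_) (Strict _⊑_) (maxMin p) (maxMin q)
  ◁⇒lex {x , y} {a , b} (le , not-ge)
    with le (max x y) (min x y) (max a b) (min a b) (max-isMax x y) (min-isMin x y) (max-isMax a b) (min-isMin a b)
  ... | inj₁ max⊏ = inj₁ max⊏
  ... | inj₂ (max≡ , min⊑) =
    inj₂ (max≡ , min⊑ , λ min≡ → not-ge (PairLe-intro (≡.sym max≡) (⊑-reflexive (≡.sym min≡))))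

  ◁-wellFounded : WellFounded _◁_
  ◁-wellFounded = Subrelation.wellFounded ◁⇒lex (On.wellFounded maxMin (×-wellFounded wf wf))

-- Finite shadowing of ⊑ and the poset axioms of ≤ are only needed for the
-- existence of the monotone adjustment, which is assumed here.
proposition4p6 : (M : Set) (_≤_ : M → M → Set) → IsPosetOn M _≤_ →
    (D : DistributiveLattice 0ℓ 0ℓ) →
    (d : M → M → DistributiveLattice.Carrier D) →
    (f : M → DistributiveLattice.Carrier D) →
    (∀ x y → x ≤ y → _≤D_ D (f x) (f y)) →
    (_⊑_ : M → M → Set) → IsWellOrdering M _⊑_ →
    IsFinitelyShadowingOrder _≤_ _⊑_ →
    (d' : M → M → DistributiveLattice.Carrier D) →
    IsMonotoneAdjustment D _≤_ _⊑_ d d' →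
    (∀ x y → _≤D_ D (f x) (DistributiveLattice._∨_ D (f y) (d x y))) →
    ∀ a b → _≤D_ D (f a) (DistributiveLattice._∨_ D (f b) (d' a b))
proposition4p6 M _≤_ _ D d f f-isotone _⊑_ wo _ d' adjustment d-bound a b =
  WfAll.wfRec ◁-wellFounded 0ℓ Bounded bounded (a , b)
  where
  open DistributiveLattice D
  open DistributiveLatticeProperties D
  open PairOrder wo
  open PartialOrderReasoning poset

  Bounded : M × M → Set
  Bounded (a , b) = _≤D_ D (f a) (f b ∨ d' a b)

  bounded : ∀ p → WfRec _◁_ Bounded p → Bounded p
  bounded (a , b) ih =
    let m , m-meet , m≤d' = monotoneAdjustment-meetPart≤ adjustment a b
    in begin
      f a          ≤⟨ finitaryMeet-∨-greatest m-meet S∧-bounded ⟩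
      f b ∨ m      ≤⟨ ∨-monoʳ-≤ (f b) m≤d' ⟩
      f b ∨ d' a b ∎
    where
    S∧-bounded : ∀ s → S∧ D _≤_ _⊑_ d d' a b s → _≤D_ D (f a) (f b ∨ s)
    S∧-bounded s (inj₁ s≈d) = begin
      f a          ≤⟨ d-bound a b ⟩
      f b ∨ d a b  ≈⟨ ∨-congˡ (sym s≈d) ⟩
      f b ∨ s      ∎
    S∧-bounded s (inj₂ (x , y , xy◁ab , a≤x , y≤b , s≈d')) = begin
      f a          ≤⟨ f-isotone a x a≤x ⟩
      f x          ≤⟨ ih {x , y} xy◁ab ⟩
      f y ∨ d' x y ≤⟨ ∨-monoˡ-≤ (d' x y) (f-isotone y b y≤b) ⟩
      f b ∨ d' x y ≈⟨ ∨-congˡ (sym s≈d') ⟩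
      f b ∨ s      ∎
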